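{- Let $\mathcal{G}$ be a nonbipartite $\mathcal{F}_{g,l}$-graph of order $n\geq g+1$ with $g\geq 5$ and $\gamma(\mathcal{G})=\frac{n-1}{2}$, and suppose exactly $f$ vertices of the cycle $\mathbb{C}=v_1\cdots v_gv_1$ are not $p$-dominators. Then: (i) if $f=g$, then $g=5$; (ii) if $f\neq g$, then $f\leq 3$ and $f\neq 2$; (iii) if $f=3$, then these three vertices are consecutive on $\mathbb{C}$, i.e., they are $v_{i-1},v_i,v_{i+1}$ for some $1\leq i<g$ (with $v_0=v_g$), and every vertex of $V(\mathbb{C})\setminus\{v_{i-1},v_i,v_{i+1}\}$ and every vertex of $\{v_{g+1},\ldots,v_{g+l-1}\}$ is a $p$-dominator.
   Context: All graphs are simple and connected. $\gamma$ is the domination number. A pendant vertex has degree 1; a $p$-dominator is a vertex adjacent to a pendant vertex. The lollipop graph $L_{g,l}$ ($l\geq 1$) consists of a cycle $\mathbb{C}=v_1v_2\cdots v_gv_1$ and a path $\mathbb{P}=v_gv_{g+1}\cdots v_{g+l}$. An $F_{g,l}$-graph of order $n$ is obtained from $L_{g,l}$ by attaching $n-g-l$ pendant vertices to some nonpendant vertices of $L_{g,l}$. An $\mathcal{F}_{g,l}$-graph is an $F_{g,l}$-graph in which every $p$-dominator other than $v_{g+l-1}$ is adjacent to exactly one pendant vertex. -}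

module Defs where

open import Data.Bool using (Bool; true; false; _∧_; _∨_)
open import Data.Nat using (ℕ; zero; suc; _+_; _∸_; _≡ᵇ_)
open import Data.Fin using (Fin; toℕ; splitAt)
open import Data.Fin.Subset using (Subset; _∈_; _∉_; ∣_∣)
open import Data.Vec using (tabulate)
open import Data.Sum using (_⊎_; inj₁; inj₂)
open import Data.Product using (Σ; _×_)
open import Relation.Binary.PropositionalEquality using (_≡_; _≢_)
open import Relation.Nullary using (¬_)

Graph : ℕ → Set
Graph n = Fin n → Fin n → Bool

N : ∀ {n} → Graph n → Fin n → Subset n
N G v = tabulate (λ u → G v u)

degree : ∀ {n} → Graph n → Fin n → ℕ
degree G v = ∣ N G v ∣

IsPendant : ∀ {n} → Graph n → Fin n → Set
IsPendant G v = degree G v ≡ 1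

IsPDominator : ∀ {n} → Graph n → Fin n → Set
IsPDominator G v = Σ _ λ u → G v u ≡ true × IsPendant G u

AdjToExactlyOnePendant : ∀ {n} → Graph n → Fin n → Set
AdjToExactlyOnePendant G v =
  IsPDominator G v ×
  (∀ u u' → G v u ≡ true → IsPendant G u →
            G v u' ≡ true → IsPendant G u' → u ≡ u')

IsBipartite : ∀ {n} → Graph n → Set
IsBipartite {n} G = Σ (Fin n → Bool) λ c → ∀ u v → G u v ≡ true → c u ≢ c v

IsDominating : ∀ {n} → Graph n → Subset n → Set
IsDominating G D = ∀ v → v ∈ D ⊎ Σ _ (λ u → u ∈ D × G u v ≡ true)

IsDominationNumber : ∀ {n} → Graph n → ℕ → Set
IsDominationNumber G k =
  Σ _ (λ D → IsDominating G D × ∣ D ∣ ≡ k) ×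
  (∀ D → IsDominating G D → k Data.Nat.≤ ∣ D ∣)

-- Vertex with index i < g + l (0-based) is v_{i+1} of the lollipop
-- L_{g,l}; vertex g + l + j (j < m) is the j-th attached pendant vertex,
-- attached to the nonpendant lollipop vertex v_{host j + 1}
-- (host j ranges over indices 0 .. g+l-2, i.e. v_1 .. v_{g+l-1}).

-- directed lollipop edges between 0-based indices:
-- consecutive vertices v_{i+1} v_{i+2}  (cycle and path edges), and v_1 v_g
lollStep : ℕ → ℕ → ℕ → Bool
lollStep g i j = (suc i ≡ᵇ j) ∨ ((i ≡ᵇ 0) ∧ (suc j ≡ᵇ g))

Fedge : (g l m : ℕ) → (Fin m → Fin (g + l ∸ 1)) → Fin (g + l + m) → Fin (g + l + m) → Bool
Fedge g l m host u v with splitAt (g + l) u | splitAt (g + l) v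
... | inj₁ a | inj₁ b = lollStep g (toℕ a) (toℕ b)
... | inj₁ a | inj₂ p = toℕ a ≡ᵇ toℕ (host p)
... | inj₂ _ | _      = false

Fgraph : (g l m : ℕ) → (Fin m → Fin (g + l ∸ 1)) → Graph (g + l + m)
Fgraph g l m host u v = Fedge g l m host u v ∨ Fedge g l m host v u

-- 0-based index of the cycle predecessor of v_{j+1} (j < g), with v_0 = v_g
prevOnCycle : ℕ → ℕ → ℕ
prevOnCycle g zero    = g ∸ 1
prevOnCycle g (suc j) = j

cyc : (g l m : ℕ) → Fin g → Fin (g + l + m)
cyc g l m i = (i Data.Fin.↑ˡ l) Data.Fin.↑ˡ m

module Submission where

-- Call the vertices of the lollipop that are not p-dominators gaps, and let B be the
-- set of p-dominators.  A set D ⊇ B dominating the lollipop minus its pendant end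
-- v_{g+l} extends to a dominating set of the whole graph, and |B| ≤ m + 1, so
-- γ = (n − 1)/2 gives (g + l − 1) + |B| ≤ 2|D| + 1 for every such D.  Apply this to
-- the greedy set built along v₁ v₂ … (take a vertex if it is in B or its predecessor
-- is still undominated): 2(g + l − 1) + |B| − 2|D| is always at least g + l − 1 and
-- may exceed it by one only, which leaves room for a single isolated gap or a single
-- run of three consecutive gaps.  What survives is no gap, one gap, three consecutive
-- gaps, the gaps v_g v₁ v₂, or (for g = 5) gaps on the whole cycle; the runs of three
-- meeting the chord v₁v_g in any other way are excluded by the explicit dominating
-- sets B and B ∪ {v_g}.  Counting gaps on the cycle gives (i)–(iii).

open import Defs
open import Data.Bool using (Bool; true; false; _∧_; _∨_; not; T)
open import Data.Bool.Properties using (∨-identityʳ; ∨-zeroʳ; ∧-zeroʳ; ∨-comm)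
open import Data.Empty using (⊥; ⊥-elim)
open import Data.Fin using (Fin; toℕ; fromℕ<; _↑ˡ_; _↑ʳ_; splitAt) renaming (zero to fzero; suc to fsuc)
open import Data.Fin.Properties
  using (toℕ-↑ˡ; toℕ-fromℕ<; toℕ-injective; splitAt-↑ˡ; splitAt-↑ʳ; splitAt⁻¹-↑ˡ; splitAt⁻¹-↑ʳ; toℕ<n)
open import Data.Fin.Subset using (Subset; _∈_; ∣_∣)
open import Data.Nat
open import Data.Nat.Properties
open import Algebra.Properties.CommutativeSemigroup +-commutativeSemigroup using (interchange)
open import Data.Nat.Tactic.RingSolver using (solve-∀)
open import Data.Product using (Σ; _×_; _,_; ∃-syntax)
open import Data.Sum using (_⊎_; inj₁; inj₂; [_,_]′)
open import Data.Unit using (tt)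
open import Data.Vec using (tabulate; lookup)
open import Data.Vec.Properties using (lookup∘tabulate; lookup⇒[]=; []=⇒lookup; tabulate∘lookup; tabulate-cong)
open import Function using (_∘_)
open import Function.Bundles using (_⇔_; mk⇔; Equivalence)
open import Relation.Binary.PropositionalEquality
open import Relation.Nullary using (¬_; yes; no)

true-or-false : ∀ v → v ≡ true ⊎ v ≡ false
true-or-false true  = inj₁ refl
true-or-false false = inj₂ refl

true≢false : true ≢ false
true≢false ()

bit : Bool → ℕ
bit true  = 1
bit false = 0

count : (ℕ → Bool) → ℕ → ℕ → ℕ
count p a zero    = 0
count p a (suc k) = bit (p a) + count p (suc a) k

count-+ : ∀ p a j k → count p a (j + k) ≡ count p a j + count p (a + j) k
count-+ p a zero k = cong (λ a′ → count p a′ k) (sym (+-identityʳ a))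
count-+ p a (suc j) k = begin
  bit (p a) + count p (suc a) (j + k)
    ≡⟨ cong (bit (p a) +_) (count-+ p (suc a) j k) ⟩
  bit (p a) + (count p (suc a) j + count p (suc a + j) k)
    ≡⟨ cong (λ a′ → bit (p a) + (count p (suc a) j + count p a′ k)) (sym (+-suc a j)) ⟩
  bit (p a) + (count p (suc a) j + count p (a + suc j) k)
    ≡⟨ sym (+-assoc (bit (p a)) _ _) ⟩
  count p a (suc j) + count p (a + suc j) k ∎
  where open ≡-Reasoning

count-≤-window : ∀ p a w k → a + w ≤ k → count p a w ≤ count p 0 k
count-≤-window p a w k a+w≤k with m≤n⇒∃[o]m+o≡n a+w≤k
... | r , refl = begin
  count p a w                           ≤⟨ m≤n+m _ _ ⟩
  count p 0 a + count p a w             ≤⟨ m≤m+n _ _ ⟩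
  count p 0 a + count p a w + count p (a + w) r
    ≡⟨ +-assoc (count p 0 a) _ _ ⟩
  count p 0 a + (count p a w + count p (a + w) r)
    ≡⟨ cong (count p 0 a +_) (sym (count-+ p a w r)) ⟩
  count p 0 a + count p a (w + r)       ≡⟨ sym (count-+ p 0 a (w + r)) ⟩
  count p 0 (a + (w + r))               ≡⟨ cong (count p 0) (sym (+-assoc a w r)) ⟩
  count p 0 (a + w + r)                 ∎
  where open ≤-Reasoning

count-≤-windows : ∀ p a v b w k → a + v ≤ b → b + w ≤ k →
                  count p a v + count p b w ≤ count p 0 k
count-≤-windows p a v b w k a+v≤b b+w≤k with m≤n⇒∃[o]m+o≡n b+w≤k
... | r , refl = begin
  count p a v + count p b w
    ≤⟨ +-mono-≤ (count-≤-window p a v b a+v≤b) (m≤m+n _ (count p (b + w) r)) ⟩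
  count p 0 b + (count p b w + count p (b + w) r)
    ≡⟨ cong (count p 0 b +_) (sym (count-+ p b w r)) ⟩
  count p 0 b + count p b (w + r)      ≡⟨ sym (count-+ p 0 b (w + r)) ⟩
  count p 0 (b + (w + r))              ≡⟨ cong (count p 0) (sym (+-assoc b w r)) ⟩
  count p 0 (b + w + r)                ∎
  where open ≤-Reasoning

count-mono-on : ∀ p q a k → (∀ i → a ≤ i → i < a + k → bit (p i) ≤ bit (q i)) →
                count p a k ≤ count q a k
count-mono-on p q a zero p≤q = z≤n
count-mono-on p q a (suc k) p≤q =
  +-mono-≤ (p≤q a ≤-refl a<a+suc) (count-mono-on p q (suc a) k λ i a<i i< →
    p≤q i (<⇒≤ a<i) (subst (i <_) (sym (+-suc a k)) i<))
  where a<a+suc : a < a + suc k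
        a<a+suc = subst (a <_) (sym (+-suc a k)) (s≤s (m≤m+n a k))

count-mono : ∀ p q a k → (∀ i → bit (p i) ≤ bit (q i)) → count p a k ≤ count q a k
count-mono p q a k p≤q = count-mono-on p q a k (λ i _ _ → p≤q i)

count-zero-on : ∀ p a k → (∀ i → a ≤ i → i < a + k → p i ≡ false) → count p a k ≡ 0
count-zero-on p a zero    p≡false = refl
count-zero-on p a (suc k) p≡false =
  cong₂ _+_ (cong bit (p≡false a ≤-refl (subst (a <_) (sym (+-suc a k)) (s≤s (m≤m+n a k)))))
            (count-zero-on p (suc a) k λ i a<i i< →
              p≡false i (<⇒≤ a<i) (subst (i <_) (sym (+-suc a k)) i<))

bit-∨ : ∀ x y → bit (x ∨ y) ≤ bit x + bit y
bit-∨ true  y = s≤s z≤n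
bit-∨ false y = ≤-refl

count-∨ : ∀ p q a k → count (λ i → p i ∨ q i) a k ≤ count p a k + count q a k
count-∨ p q a zero = z≤n
count-∨ p q a (suc k) = begin
  bit (p a ∨ q a) + count (λ i → p i ∨ q i) (suc a) k
    ≤⟨ +-mono-≤ (bit-∨ (p a) (q a)) (count-∨ p q (suc a) k) ⟩
  bit (p a) + bit (q a) + (count p (suc a) k + count q (suc a) k)
    ≡⟨ interchange (bit (p a)) (bit (q a)) _ _ ⟩
  count p a (suc k) + count q a (suc k) ∎
  where open ≤-Reasoning

bit-not : ∀ x → bit x + bit (not x) ≡ 1
bit-not true  = refl
bit-not false = refl

count-+-count-not : ∀ p a k → count p a k + count (λ i → not (p i)) a k ≡ k
count-+-count-not p a zero = refl
count-+-count-not p a (suc k) = begin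
  bit (p a) + count p (suc a) k + (bit (not (p a)) + count p̅ (suc a) k)
    ≡⟨ interchange (bit (p a)) (count p (suc a) k) _ _ ⟩
  bit (p a) + bit (not (p a)) + (count p (suc a) k + count p̅ (suc a) k)
    ≡⟨ cong₂ _+_ (bit-not (p a)) (count-+-count-not p (suc a) k) ⟩
  suc k ∎
  where
  open ≡-Reasoning
  p̅ : ℕ → Bool
  p̅ i = not (p i)

≡ᵇ-refl : ∀ n → (n ≡ᵇ n) ≡ true
≡ᵇ-refl zero    = refl
≡ᵇ-refl (suc n) = ≡ᵇ-refl n

≢⇒≡ᵇ≡false : ∀ m n → m ≢ n → (m ≡ᵇ n) ≡ false
≢⇒≡ᵇ≡false zero    zero    m≢n = ⊥-elim (m≢n refl)
≢⇒≡ᵇ≡false zero    (suc n) m≢n = refl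
≢⇒≡ᵇ≡false (suc m) zero    m≢n = refl
≢⇒≡ᵇ≡false (suc m) (suc n) m≢n = ≢⇒≡ᵇ≡false m n (m≢n ∘ cong suc)

≡ᵇ≡true⇒≡ : ∀ m n → (m ≡ᵇ n) ≡ true → m ≡ n
≡ᵇ≡true⇒≡ m n e = ≡ᵇ⇒≡ m n (subst T (sym e) tt)

count-≡ᵇ≤1 : ∀ c a k → count (_≡ᵇ c) a k ≤ 1
count-≡ᵇ≤1 c a zero = z≤n
count-≡ᵇ≤1 c a (suc k) with a ≟ c
... | yes refl = ≤-reflexive (cong₂ (λ x y → bit x + y) (≡ᵇ-refl a)
        (count-zero-on (_≡ᵇ a) (suc a) k λ i a<i _ → ≢⇒≡ᵇ≡false i a (λ i≡a → <-irrefl (sym i≡a) a<i)))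
... | no a≢c = subst (λ x → bit x + count (_≡ᵇ c) (suc a) k ≤ 1) (sym (≢⇒≡ᵇ≡false a c a≢c))
                     (count-≡ᵇ≤1 c (suc a) k)

count-two : ∀ p a → p a ≡ true → p (suc a) ≡ true → count p a 2 ≡ 2
count-two p a pa pa+1 rewrite pa | pa+1 = refl

count-three : ∀ p a → p a ≡ true → p (suc a) ≡ true → p (2 + a) ≡ true → count p a 3 ≡ 3
count-three p a pa pa+1 pa+2 rewrite pa | pa+1 | pa+2 = refl

countFin : ∀ n → (Fin n → Bool) → ℕ
countFin zero    p = 0
countFin (suc n) p = bit (p fzero) + countFin n (p ∘ fsuc)

∣tabulate∣≡countFin : ∀ n (p : Fin n → Bool) → ∣ tabulate p ∣ ≡ countFin n p
∣tabulate∣≡countFin zero    p = refl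
∣tabulate∣≡countFin (suc n) p with p fzero
... | true  = cong suc (∣tabulate∣≡countFin n (p ∘ fsuc))
... | false = ∣tabulate∣≡countFin n (p ∘ fsuc)

countFin-cong : ∀ n (p q : Fin n → Bool) → (∀ i → p i ≡ q i) → countFin n p ≡ countFin n q
countFin-cong zero    p q p≡q = refl
countFin-cong (suc n) p q p≡q = cong₂ _+_ (cong bit (p≡q fzero)) (countFin-cong n (p ∘ fsuc) (q ∘ fsuc) (p≡q ∘ fsuc))

countFin-+ : ∀ n m (p : Fin (n + m) → Bool) →
             countFin (n + m) p ≡ countFin n (λ i → p (i ↑ˡ m)) + countFin m (λ j → p (n ↑ʳ j))
countFin-+ zero    m p = refl
countFin-+ (suc n) m p = trans (cong (bit (p fzero) +_) (countFin-+ n m (p ∘ fsuc))) (sym (+-assoc (bit (p fzero)) _ _))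

countFin-false : ∀ n (p : Fin n → Bool) → (∀ i → p i ≡ false) → countFin n p ≡ 0
countFin-false n p p≡false = trans (countFin-cong n p (λ _ → false) p≡false) (all-false n)
  where all-false : ∀ n → countFin n (λ _ → false) ≡ 0
        all-false zero    = refl
        all-false (suc n) = all-false n

countFin-toℕ : ∀ n (q : ℕ → Bool) → countFin n (λ i → q (toℕ i)) ≡ count q 0 n
countFin-toℕ n q = trans (countFin-cong n _ _ λ i → cong q (sym (+-identityʳ (toℕ i)))) (shifted n 0)
  where shifted : ∀ n a → countFin n (λ i → q (toℕ i + a)) ≡ count q a n
        shifted zero    a = refl
        shifted (suc n) a = cong (bit (q a) +_)
          (trans (countFin-cong n _ _ (λ i → cong q (sym (+-suc (toℕ i) a)))) (shifted n (suc a)))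

count-≥1 : ∀ p c n → p c ≡ true → c < n → 1 ≤ count p 0 n
count-≥1 p c n pc c<n = ≤-trans (≤-reflexive (cong (λ x → bit x + 0) (sym pc)))
  (count-≤-window p c 1 n (subst (_≤ n) (+-comm 1 c) c<n))

count-≥2 : ∀ p c d n → p c ≡ true → p d ≡ true → c < d → d < n → 2 ≤ count p 0 n
count-≥2 p c d n pc pd c<d d<n = ≤-trans (≤-reflexive (cong₂ (λ x y → (bit x + 0) + (bit y + 0)) (sym pc) (sym pd)))
  (count-≤-windows p c 1 d 1 n (subst (_≤ d) (+-comm 1 c) c<d) (subst (_≤ n) (+-comm 1 d) d<n))

inImage : ∀ {m n} → (Fin m → Fin n) → ℕ → Bool
inImage {zero}  f i = false
inImage {suc m} f i = (toℕ (f fzero) ≡ᵇ i) ∨ inImage (f ∘ fsuc) i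

inImage-intro : ∀ {m n} (f : Fin m → Fin n) j → inImage f (toℕ (f j)) ≡ true
inImage-intro f fzero = cong (_∨ inImage (f ∘ fsuc) (toℕ (f fzero))) (≡ᵇ-refl (toℕ (f fzero)))
inImage-intro f (fsuc j) = trans (cong ((toℕ (f fzero) ≡ᵇ toℕ (f (fsuc j))) ∨_) (inImage-intro (f ∘ fsuc) j)) (∨-zeroʳ _)

inImage-elim : ∀ {m n} (f : Fin m → Fin n) i → inImage f i ≡ true → ∃[ j ] (toℕ (f j) ≡ i)
inImage-elim {zero}  f i ()
inImage-elim {suc m} f i e with true-or-false (toℕ (f fzero) ≡ᵇ i)
... | inj₁ hit = fzero , ≡ᵇ≡true⇒≡ _ _ hit
... | inj₂ miss with inImage-elim (f ∘ fsuc) i (subst (λ x → (x ∨ inImage (f ∘ fsuc) i) ≡ true) miss e)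
...   | j , fj≡i = fsuc j , fj≡i

count-inImage≤ : ∀ {m n} (f : Fin m → Fin n) a k → count (inImage f) a k ≤ m
count-inImage≤ {zero}  f a k = ≤-reflexive (count-zero-on _ a k (λ _ _ _ → refl))
count-inImage≤ {suc m} f a k = ≤-trans (count-∨ _ _ a k)
  (+-mono-≤ (≤-trans (count-mono _ (_≡ᵇ toℕ (f fzero)) a k hit-sym) (count-≡ᵇ≤1 (toℕ (f fzero)) a k))
            (count-inImage≤ (f ∘ fsuc) a k))
  where
  hit-sym : ∀ i → bit (toℕ (f fzero) ≡ᵇ i) ≤ bit (i ≡ᵇ toℕ (f fzero))
  hit-sym i with true-or-false (toℕ (f fzero) ≡ᵇ i)
  ... | inj₂ miss rewrite miss = z≤n
  ... | inj₁ hit = ≤-reflexive (cong bit (trans hit (sym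
        (subst (λ y → (i ≡ᵇ y) ≡ true) (sym (≡ᵇ≡true⇒≡ _ _ hit)) (≡ᵇ-refl i)))))

-- The greedy sweep along a path v₀ v₁ … with forced vertices B puts vᵢ into D when it
-- lies in B or vᵢ₋₁ is still undominated; the mark at vᵢ records the status of vᵢ₋₁.
data Mark : Set where
  chosen covered exposed : Mark

isExposed : Mark → Bool
isExposed exposed = true
isExposed _       = false

step : Mark → Bool → Mark
step _       true  = chosen
step exposed false = chosen
step chosen  false = covered
step covered false = exposed

cost : Mark → Bool → ℕ
cost _       true  = 1
cost exposed false = 0
cost chosen  false = 2
cost covered false = 2

-- cost is 2 + [v ∈ B] − 2 [v ∈ D], so it sums to 2 · length + |B| − 2 |D|.
cost-spec : ∀ s x → 2 + bit x ≡ 2 * bit (x ∨ isExposed s) + cost s x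
cost-spec s       true  = refl
cost-spec chosen  false = refl
cost-spec covered false = refl
cost-spec exposed false = refl

step-chosen : ∀ s x → step s x ≡ chosen → (x ∨ isExposed s) ≡ true
step-chosen s       true  _ = refl
step-chosen exposed false _ = refl
step-chosen chosen  false ()
step-chosen covered false ()

cost-≥ : ∀ s x {e k} → k ≤ e + bit (isExposed (step s x)) →
         suc k ≤ cost s x + e + bit (isExposed s)
cost-≥ s       true  {e} k≤e = s≤s (≤-trans k≤e (+-monoʳ-≤ e z≤n))
cost-≥ chosen  false {e} k≤e = s≤s (≤-trans k≤e (n≤1+n _))
cost-≥ covered false {e} k≤e = s≤s (≤-trans k≤e (≤-reflexive (trans (+-comm e 1) (cong suc (sym (+-identityʳ e))))))
cost-≥ exposed false {e} k≤e = ≤-trans (s≤s k≤e) (≤-reflexive (trans (cong suc (+-identityʳ e)) (+-comm 1 e)))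

module Sweep (b : ℕ → Bool) where

  excess : Mark → ℕ → ℕ → ℕ
  excess s a zero    = 0
  excess s a (suc k) = cost s (b a) + excess (step s (b a)) (suc a) k

  markAfter : Mark → ℕ → ℕ → Mark
  markAfter s a zero    = s
  markAfter s a (suc k) = markAfter (step s (b a)) (suc a) k

  excess-unfold : ∀ s a k x → b a ≡ x → excess s a (suc k) ≡ cost s x + excess (step s x) (suc a) k
  excess-unfold s a k x refl = refl

  excess-+ : ∀ s a j k → excess s a (j + k) ≡ excess s a j + excess (markAfter s a j) (a + j) k
  excess-+ s a zero k = cong (λ a′ → excess s a′ k) (sym (+-identityʳ a))
  excess-+ s a (suc j) k = begin
    cost s (b a) + excess s′ (suc a) (j + k)
      ≡⟨ cong (cost s (b a) +_) (excess-+ s′ (suc a) j k) ⟩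
    cost s (b a) + (excess s′ (suc a) j + excess (markAfter s′ (suc a) j) (suc a + j) k)
      ≡⟨ cong (λ a′ → cost s (b a) + (excess s′ (suc a) j + excess (markAfter s′ (suc a) j) a′ k)) (sym (+-suc a j)) ⟩
    cost s (b a) + (excess s′ (suc a) j + excess (markAfter s′ (suc a) j) (a + suc j) k)
      ≡⟨ sym (+-assoc (cost s (b a)) _ _) ⟩
    excess s a (suc j) + excess (markAfter s a (suc j)) (a + suc j) k ∎
    where
    open ≡-Reasoning
    s′ : Mark
    s′ = step s (b a)

  excess-≥-length : ∀ s a k → k ≤ excess s a k + bit (isExposed s)
  excess-≥-length s a zero    = z≤n
  excess-≥-length s a (suc k) = cost-≥ s (b a) (excess-≥-length (step s (b a)) (suc a) k)

  excess-≥-length-unexposed : ∀ s a k → isExposed s ≡ false → k ≤ excess s a k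
  excess-≥-length-unexposed s a k s-unexposed =
    ≤-trans (excess-≥-length s a k) (≤-reflexive (trans (cong (λ e → excess s a k + bit e) s-unexposed) (+-identityʳ _)))

  excess-≥-length-with-gap : ∀ a k x → a ≤ x → x < a + k → b x ≡ false → suc k ≤ excess chosen a k
  excess-≥-length-with-gap a zero x a≤x x<a _ =
    ⊥-elim (<-irrefl refl (≤-trans x<a (≤-trans (≤-reflexive (+-identityʳ a)) a≤x)))
  excess-≥-length-with-gap a (suc k) x a≤x x<a+k bx with b a in ba
  ... | false = s≤s (s≤s (excess-≥-length-unexposed covered (suc a) k refl))
  ... | true  = s≤s (excess-≥-length-with-gap (suc a) k x a<x (subst (x <_) (+-suc a k) x<a+k) bx)
    where
    a<x : a < x
    a<x with m≤n⇒m<n∨m≡n a≤x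
    ... | inj₁ a<x  = a<x
    ... | inj₂ refl with () ← trans (sym ba) bx

  AllB : ℕ → ℕ → Set
  AllB a e = ∀ i → a ≤ i → i < e → b i ≡ true

  AllB-cons : ∀ a e → b a ≡ true → AllB (suc a) e → AllB a e
  AllB-cons a e ba all i a≤i i<e with m≤n⇒m<n∨m≡n a≤i
  ... | inj₁ a<i = all i a<i i<e
  ... | inj₂ refl = ba

  AllB-++ : ∀ a c e → AllB a c → AllB c e → AllB a e
  AllB-++ a c e all₁ all₂ i a≤i i<e with i <? c
  ... | yes i<c = all₁ i a≤i i<c
  ... | no  i≮c = all₂ i (≮⇒≥ i≮c) i<e

  AllB-head : ∀ a k → AllB a (a + suc k) → b a ≡ true
  AllB-head a k all = all a ≤-refl (subst (a <_) (sym (+-suc a k)) (s≤s (m≤m+n a k)))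

  AllB-tail : ∀ a k → AllB a (a + suc k) → AllB (suc a) (suc a + k)
  AllB-tail a k all i a<i i< = all i (<⇒≤ a<i) (subst (i <_) (sym (+-suc a k)) i<)

  excess-AllB : ∀ s a k → AllB a (a + k) → excess s a k ≡ k
  excess-AllB s a zero    all = refl
  excess-AllB s a (suc k) all = trans (excess-unfold s a k true (AllB-head a k all))
                                      (cong suc (excess-AllB chosen (suc a) k (AllB-tail a k all)))

  markAfter-AllB : ∀ a k → AllB a (a + k) → markAfter chosen a k ≡ chosen
  markAfter-AllB a zero    all = refl
  markAfter-AllB a (suc k) all rewrite AllB-head a k all = markAfter-AllB (suc a) k (AllB-tail a k all)

  first-gap : ∀ a k → AllB a (a + k) ⊎ ∃[ x ] (a ≤ x × x < a + k × AllB a x × b x ≡ false)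
  first-gap a zero = inj₁ λ i a≤i i<a → ⊥-elim (<-irrefl refl (≤-trans i<a (≤-trans (≤-reflexive (+-identityʳ a)) a≤i)))
  first-gap a (suc k) with b a in ba
  ... | false = inj₂ (a , ≤-refl , subst (a <_) (sym (+-suc a k)) (s≤s (m≤m+n a k)) ,
                      (λ i a≤i i<a → ⊥-elim (<-irrefl refl (≤-trans i<a a≤i))) , ba)
  ... | true with first-gap (suc a) k
  ...   | inj₁ all = inj₁ (AllB-cons a (a + suc k) ba (subst (AllB (suc a)) (sym (+-suc a k)) all))
  ...   | inj₂ (x , a<x , x< , all , bx) =
          inj₂ (x , <⇒≤ a<x , subst (x <_) (sym (+-suc a k)) x< , AllB-cons a x ba all , bx)

  excess-double-gap : ∀ x k → b x ≡ false → b (suc x) ≡ false →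
                      excess chosen x (2 + k) ≡ 4 + excess exposed (2 + x) k
  excess-double-gap x k bx bx₁ = trans (excess-unfold chosen x (suc k) false bx)
    (cong (2 +_) (excess-unfold covered (suc x) k false bx₁))

  excess-triple-gap : ∀ x k → b x ≡ false → b (suc x) ≡ false → b (2 + x) ≡ false →
                      excess chosen x (3 + k) ≡ 4 + excess chosen (3 + x) k
  excess-triple-gap x k bx bx₁ bx₂ = trans (excess-double-gap x (suc k) bx bx₁)
    (cong (4 +_) (excess-unfold exposed (2 + x) k false bx₂))

  AllB-or-excess> : ∀ a k → AllB a (a + k) ⊎ suc k ≤ excess chosen a k
  AllB-or-excess> a k with first-gap a k
  ... | inj₁ all = inj₁ all
  ... | inj₂ (y , a≤y , y< , _ , by) = inj₂ (excess-≥-length-with-gap a k y a≤y y< by)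

+-shift : ∀ i x k → x + (i + k) ≡ i + x + k
+-shift = solve-∀

module Gaps (M : ℕ) (b : ℕ → Bool) (bM : b M ≡ true) where
  open Sweep b

  len : ℕ
  len = suc M

  gap≢M : ∀ x → b x ≡ false → x ≢ M
  gap≢M x bx refl with () ← trans (sym bM) bx

  gap-not-last : ∀ x k → x + suc k ≡ len → b x ≡ false → 0 < k
  gap-not-last x zero    x+1≡len bx = ⊥-elim (gap≢M x bx (suc-injective (trans (+-comm 1 x) x+1≡len)))
  gap-not-last x (suc k) _       _  = s≤s z≤n

  Costly : ℕ → ℕ → Set
  Costly x k = 2 + k ≤ excess chosen x k

  data GapTail (x : ℕ) : Set where
    single : AllB (suc x) len → GapTail x
    triple : b (suc x) ≡ false → b (2 + x) ≡ false → 3 + x ≤ len → AllB (3 + x) len → GapTail x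

  gap-pair-tail : ∀ x k → x + (2 + k) ≡ len → b x ≡ false → b (suc x) ≡ false → Costly x (2 + k) ⊎ GapTail x
  gap-pair-tail x k eq bx bx₁ with gap-not-last (suc x) k (trans (sym (+-suc x (suc k))) eq) bx₁
  gap-pair-tail x (suc k) eq bx bx₁ | _ with true-or-false (b (2 + x))
  ... | inj₁ bx₂ = inj₁ (subst (5 + k ≤_) (sym E) (+-monoʳ-≤ 5 (excess-≥-length-unexposed chosen (3 + x) k refl)))
    where
    E : excess chosen x (3 + k) ≡ 5 + excess chosen (3 + x) k
    E = trans (excess-double-gap x (suc k) bx bx₁) (cong (4 +_) (excess-unfold exposed (2 + x) k true bx₂))
  ... | inj₂ bx₂ with gap-not-last (2 + x) k (trans (sym (+-shift 2 x (suc k))) eq) bx₂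
  gap-pair-tail x (suc (suc k)) eq bx bx₁ | _ | inj₂ bx₂ | _ with true-or-false (b (3 + x))
  ... | inj₂ bx₃ = inj₁ (subst (6 + k ≤_) (sym E) (+-monoʳ-≤ 6 (excess-≥-length-unexposed covered (4 + x) k refl)))
    where
    E : excess chosen x (4 + k) ≡ 6 + excess covered (4 + x) k
    E = trans (excess-triple-gap x (suc k) bx bx₁ bx₂) (cong (4 +_) (excess-unfold chosen (3 + x) k false bx₃))
  ... | inj₁ bx₃ with AllB-or-excess> (4 + x) k
  ...   | inj₁ all = inj₂ (triple bx₁ bx₂ 3+x≤len (AllB-cons (3 + x) len bx₃ (subst (AllB (4 + x)) eq′ all)))
    where
    eq′ : 4 + x + k ≡ len
    eq′ = trans (sym (+-shift 4 x k)) eq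
    3+x≤len : 3 + x ≤ len
    3+x≤len = subst (3 + x ≤_) eq′ (≤-trans (n≤1+n _) (m≤m+n (4 + x) k))
  ...   | inj₂ k<e = inj₁ (subst (6 + k ≤_) (sym E) (+-monoʳ-≤ 5 k<e))
    where
    E : excess chosen x (4 + k) ≡ 5 + excess chosen (4 + x) k
    E = trans (excess-triple-gap x (suc k) bx bx₁ bx₂) (cong (4 +_) (excess-unfold chosen (3 + x) k true bx₃))

  gap-tail : ∀ x k → x + suc k ≡ len → b x ≡ false → Costly x (suc k) ⊎ GapTail x
  gap-tail x k eq bx with gap-not-last x k eq bx
  gap-tail x (suc k) eq bx | _ with true-or-false (b (suc x))
  ... | inj₂ bx₁ = gap-pair-tail x k eq bx bx₁
  ... | inj₁ bx₁ with AllB-or-excess> (2 + x) k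
  ...   | inj₁ all = inj₂ (single (AllB-cons (suc x) len bx₁ (subst (AllB (2 + x)) (trans (sym (+-shift 2 x k)) eq) all)))
  ...   | inj₂ k<e = inj₁ (subst (4 + k ≤_) (sym E) (+-monoʳ-≤ 3 k<e))
    where
    E : excess chosen x (2 + k) ≡ 3 + excess chosen (2 + x) k
    E = trans (excess-unfold chosen x (suc k) false bx) (cong (2 +_) (excess-unfold covered (suc x) k true bx₁))

  data Shape (a : ℕ) : Set where
    no-gap    : AllB a len → Shape a
    gap-at    : ∀ x → a ≤ x → AllB a x → b x ≡ false → GapTail x → Shape a

  costly-after-prefix : ∀ a j k → AllB a (a + j) → Costly (a + j) k → 2 + (j + k) ≤ excess chosen a (j + k)
  costly-after-prefix a j k all costly = begin
    2 + (j + k)                           ≡⟨ sym (+-shift 2 j k) ⟩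
    j + (2 + k)                           ≤⟨ +-monoʳ-≤ j costly ⟩
    j + excess chosen (a + j) k           ≡⟨ sym (cong₂ (λ e s → e + excess s (a + j) k)
                                                         (excess-AllB chosen a j all) (markAfter-AllB a j all)) ⟩
    excess chosen a j + excess (markAfter chosen a j) (a + j) k ≡⟨ sym (excess-+ chosen a j k) ⟩
    excess chosen a (j + k)               ∎
    where open ≤-Reasoning

  shape : ∀ a k → a + k ≡ len → excess chosen a k ≤ suc k → Shape a
  shape a k eq bound with first-gap a k
  ... | inj₁ all = no-gap (subst (AllB a) eq all)
  ... | inj₂ (x , a≤x , x<a+k , all , bx) with m≤n⇒∃[o]m+o≡n a≤x
  ...   | j , refl with m≤n⇒∃[o]m+o≡n (+-cancelˡ-< a j k x<a+k)
  ...     | o , e with trans (+-suc j o) e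
  ...       | refl with gap-tail (a + j) o (trans (+-assoc a j (suc o)) eq) bx
  ...         | inj₂ tail = gap-at (a + j) (m≤m+n a j) all bx tail
  ...         | inj₁ costly = ⊥-elim (<-irrefl refl (≤-trans (costly-after-prefix a j (suc o) all costly) bound))

lollStep-suc : ∀ g i → lollStep g i (suc i) ≡ true
lollStep-suc g i = cong (_∨ ((i ≡ᵇ 0) ∧ (suc (suc i) ≡ᵇ g))) (≡ᵇ-refl (suc i))

lollStep-chord : ∀ h → lollStep (5 + h) 0 (4 + h) ≡ true
lollStep-chord h = ≡ᵇ-refl h

-- Indices 0 … M are v₁ … v_{g+l−1}, the lollipop without its pendant end, with the
-- chord v₁v_g between 0 and 4 + h; b marks the p-dominators and M = v_{g+l−1} is one.
module Lollipop (h M : ℕ) (b : ℕ → Bool) (bM : b M ≡ true) (g≤M : 4 + h ≤ M) where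
  open Sweep b
  open Gaps M b bM

  g : ℕ
  g = 5 + h

  Adjacent : ℕ → ℕ → Set
  Adjacent j i = lollStep g j i ≡ true ⊎ lollStep g i j ≡ true

  DominatedBy : (ℕ → Bool) → ℕ → Set
  DominatedBy d i = d i ≡ true ⊎ ∃[ j ] (j < len × d j ≡ true × Adjacent j i)

  Dominates : (ℕ → Bool) → Set
  Dominates d = ∀ i → i < len → DominatedBy d i

  Contains-B : (ℕ → Bool) → Set
  Contains-B d = ∀ i → i < len → b i ≡ true → d i ≡ true

  DominationBound : Set
  DominationBound = ∀ d → Contains-B d → Dominates d → len + count b 0 len ≤ 2 * count d 0 len + 1

  g-1<len : 4 + h < len
  g-1<len = s≤s g≤M

  gap<len : ∀ i → i < len → b i ≡ false → suc i < len
  gap<len i i<len bi with m≤n⇒m<n∨m≡n (≤-pred i<len)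
  ... | inj₁ i<M = s≤s i<M
  ... | inj₂ i≡M = ⊥-elim (gap≢M i bi i≡M)

  chordMark : Bool → Mark
  chordMark true  = chosen
  chordMark false = covered

  mark : ℕ → Mark
  mark zero    = chordMark (b (4 + h))
  mark (suc i) = step (mark i) (b i)

  greedy : ℕ → Bool
  greedy i = b i ∨ isExposed (mark i)

  greedy-count : ∀ a k → 2 * k + count b a k ≡ 2 * count greedy a k + excess (mark a) a k
  greedy-count a zero    = refl
  greedy-count a (suc k) = begin
    2 * suc k + (bit (b a) + count b (suc a) k)
      ≡⟨ regroup₁ k (bit (b a)) (count b (suc a) k) ⟩
    (2 + bit (b a)) + (2 * k + count b (suc a) k)
      ≡⟨ cong₂ _+_ (cost-spec (mark a) (b a)) (greedy-count (suc a) k) ⟩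
    (2 * bit (greedy a) + cost (mark a) (b a)) + (2 * count greedy (suc a) k + excess (mark (suc a)) (suc a) k)
      ≡⟨ regroup₂ (bit (greedy a)) (cost (mark a) (b a)) (count greedy (suc a) k) _ ⟩
    2 * count greedy a (suc k) + excess (mark a) a (suc k) ∎
    where
    open ≡-Reasoning
    regroup₁ : ∀ k x c → 2 * suc k + (x + c) ≡ (2 + x) + (2 * k + c)
    regroup₁ = solve-∀
    regroup₂ : ∀ y z c e → (2 * y + z) + (2 * c + e) ≡ 2 * (y + c) + (z + e)
    regroup₂ = solve-∀

  chordMark-chosen : ∀ x → chordMark x ≡ chosen → x ≡ true
  chordMark-chosen true  _ = refl
  chordMark-chosen false ()

  predecessor-in-greedy : ∀ i → i < len → mark i ≡ chosen → ∃[ j ] (j < len × greedy j ≡ true × Adjacent j i)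
  predecessor-in-greedy zero    _     m0 = 4 + h , g-1<len ,
    cong (_∨ isExposed (mark (4 + h))) (chordMark-chosen (b (4 + h)) m0) , inj₂ (lollStep-chord h)
  predecessor-in-greedy (suc i) i<len mi = i , <-trans (n<1+n i) i<len , step-chosen (mark i) (b i) mi ,
    inj₁ (lollStep-suc g i)

  greedy-dominates : Dominates greedy
  greedy-dominates i i<len with true-or-false (b i)
  ... | inj₁ bi = inj₁ (cong (_∨ isExposed (mark i)) bi)
  ... | inj₂ bi with mark i in mi
  ...   | exposed = inj₁ (∨-zeroʳ (b i))
  ...   | covered = inj₂ (suc i , gap<len i i<len bi ,
                      trans (cong₂ (λ s x → b (suc i) ∨ isExposed (step s x)) mi bi) (∨-zeroʳ _) ,
                      inj₂ (lollStep-suc g i))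
  ...   | chosen = inj₂ (predecessor-in-greedy i i<len mi)

  greedy⊇B : Contains-B greedy
  greedy⊇B i _ bi = cong (_∨ isExposed (mark i)) bi

  greedy-excess : DominationBound → excess (mark 0) 0 len ≤ suc len
  greedy-excess bound = +-cancelˡ-≤ (2 * count greedy 0 len) _ _ (begin
    2 * count greedy 0 len + excess (mark 0) 0 len ≡⟨ sym (greedy-count 0 len) ⟩
    2 * len + count b 0 len                      ≡⟨ regroup len (count b 0 len) ⟩
    len + (len + count b 0 len)                  ≤⟨ +-monoʳ-≤ len (bound greedy greedy⊇B greedy-dominates) ⟩
    len + (2 * count greedy 0 len + 1)           ≡⟨ +-comm len _ ⟩
    2 * count greedy 0 len + 1 + len             ≡⟨ +-assoc (2 * count greedy 0 len) 1 len ⟩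
    2 * count greedy 0 len + suc len             ∎)
    where
    open ≤-Reasoning
    regroup : ∀ n β → 2 * n + β ≡ n + (n + β)
    regroup = solve-∀

  nonB : ℕ → Bool
  nonB i = not (b i)

  gap-budget : ∀ β ν δ e → β + ν + β ≤ 2 * δ + 1 → δ ≤ β + e → 2 * e + 2 ≤ ν → ⊥
  gap-budget β ν δ e bound δ≤β+e 2e+2≤ν = <-irrefl refl (begin-strict
    2 * (β + e) + 1        <⟨ n<1+n _ ⟩
    suc (2 * (β + e) + 1)  ≡⟨ regroup₁ β e ⟩
    2 * β + (2 * e + 2)    ≤⟨ +-monoʳ-≤ (2 * β) 2e+2≤ν ⟩
    2 * β + ν              ≡⟨ regroup₂ β ν ⟩
    β + ν + β              ≤⟨ bound ⟩
    2 * δ + 1              ≤⟨ +-monoˡ-≤ 1 (*-monoʳ-≤ 2 δ≤β+e) ⟩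
    2 * (β + e) + 1        ∎)
    where
    open ≤-Reasoning
    regroup₁ : ∀ β e → suc (2 * (β + e) + 1) ≡ 2 * β + (2 * e + 2)
    regroup₁ = solve-∀
    regroup₂ : ∀ β ν → 2 * β + ν ≡ β + ν + β
    regroup₂ = solve-∀

  too-many-gaps : DominationBound → ∀ d e → Contains-B d → Dominates d →
                  count d 0 len ≤ count b 0 len + e → 2 * e + 2 ≤ count nonB 0 len → ⊥
  too-many-gaps bound d e d⊇B d-dom d≤ = gap-budget (count b 0 len) (count nonB 0 len) (count d 0 len) e
    (subst (λ n → n + count b 0 len ≤ 2 * count d 0 len + 1) (sym (count-+-count-not b 0 len)) (bound d d⊇B d-dom)) d≤

  gap-in-window : ∀ a p k i → a ≤ i → i < len → b i ≡ false → AllB a p → AllB (p + k) len →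
                  ∃[ t ] (t < k × i ≡ t + p)
  gap-in-window a p k i a≤i i<len bi before after with i <? p
  ... | yes i<p with () ← trans (sym (before i a≤i i<p)) bi
  ... | no i≮p with i <? p + k
  ...   | no i≮p+k with () ← trans (sym (after i (≮⇒≥ i≮p+k) i<len)) bi
  ...   | yes i<p+k = i ∸ p , +-cancelˡ-< p (i ∸ p) k (subst (_< p + k) (sym p+[i∸p]≡i) i<p+k) ,
                      trans (sym p+[i∸p]≡i) (+-comm p (i ∸ p))
    where
    p+[i∸p]≡i : p + (i ∸ p) ≡ i
    p+[i∸p]≡i = m+[n∸m]≡n (≮⇒≥ i≮p)

  NoTripleAroundChordEnd : Set
  NoTripleAroundChordEnd = AllB 0 (3 + h) → b (3 + h) ≡ false → b (4 + h) ≡ false → b (5 + h) ≡ false →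
                    6 + h ≤ len → AllB (6 + h) len → ⊥

  triple-around-chord-end : DominationBound → NoTripleAroundChordEnd
  triple-around-chord-end bound before b₃ b₄ b₅ 6+h≤len after =
    too-many-gaps bound b 0 (λ _ _ bi → bi) b-dominates (≤-reflexive (sym (+-identityʳ _))) 2≤gaps
    where
    2≤gaps : 2 ≤ count nonB 0 len
    2≤gaps = ≤-trans (s≤s (s≤s z≤n)) (≤-trans
      (≤-reflexive (sym (count-three nonB (3 + h) (cong not b₃) (cong not b₄) (cong not b₅))))
      (count-≤-window nonB (3 + h) 3 len (subst (_≤ len) (+-comm 3 (3 + h)) 6+h≤len)))
    6+h<len : 6 + h < len
    6+h<len = gap<len (5 + h) 6+h≤len b₅
    b-dominates : Dominates b
    b-dominates i i<len with true-or-false (b i)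
    ... | inj₁ bi = inj₁ bi
    ... | inj₂ bi with gap-in-window 0 (3 + h) 3 i z≤n i<len bi before (subst (λ p → AllB p len) (+-comm 3 (3 + h)) after)
    ...   | 0 , _ , refl = inj₂ (2 + h , <-trans (n<1+n _) (<-trans (n<1+n _) (<-trans (n<1+n _) 6+h≤len)) ,
                               before (2 + h) z≤n ≤-refl , inj₁ (lollStep-suc g (2 + h)))
    ...   | 1 , _ , refl = inj₂ (0 , s≤s z≤n , before 0 z≤n (s≤s z≤n) , inj₁ (lollStep-chord h))
    ...   | 2 , _ , refl = inj₂ (6 + h , 6+h<len , after (6 + h) ≤-refl 6+h<len , inj₂ (lollStep-suc g (5 + h)))
    ...   | suc (suc (suc _)) , s≤s (s≤s (s≤s ())) , _

  withChordEnd : ℕ → Bool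
  withChordEnd i = b i ∨ (i ≡ᵇ 4 + h)

  withChordEnd-B : ∀ j → b j ≡ true → withChordEnd j ≡ true
  withChordEnd-B j bj = cong (_∨ (j ≡ᵇ 4 + h)) bj

  withChordEnd-end : withChordEnd (4 + h) ≡ true
  withChordEnd-end = trans (cong (b (4 + h) ∨_) (≡ᵇ-refl (4 + h))) (∨-zeroʳ _)

  pair-and-triple : DominationBound → ∀ p → 2 < p → p + 3 ≤ len →
    b 0 ≡ false → b 1 ≡ false → AllB 2 p → b p ≡ false → b (suc p) ≡ false → b (2 + p) ≡ false →
    AllB (p + 3) len → (∀ t → t < 3 → DominatedBy withChordEnd (t + p)) → ⊥
  pair-and-triple bound p 2<p p+3≤len b₀ b₁ between bp bp₁ bp₂ after triple-dominated =
    too-many-gaps bound withChordEnd 1 (λ j _ → withChordEnd-B j) dominates size 4≤gaps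
    where
    size : count withChordEnd 0 len ≤ count b 0 len + 1
    size = ≤-trans (count-∨ b (_≡ᵇ 4 + h) 0 len) (+-monoʳ-≤ (count b 0 len) (count-≡ᵇ≤1 (4 + h) 0 len))
    4≤gaps : 4 ≤ count nonB 0 len
    4≤gaps = ≤-trans (s≤s (s≤s (s≤s (s≤s z≤n)))) (≤-trans
      (≤-reflexive (sym (cong₂ _+_ (count-two nonB 0 (cong not b₀) (cong not b₁))
                                   (count-three nonB p (cong not bp) (cong not bp₁) (cong not bp₂)))))
      (count-≤-windows nonB 0 2 p 3 len (<⇒≤ 2<p) p+3≤len))
    dominates : Dominates withChordEnd
    dominates i i<len with true-or-false (b i)
    ... | inj₁ bi = inj₁ (withChordEnd-B i bi)
    ... | inj₂ bi with i <? 2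
    ...   | yes (s≤s z≤n) = inj₂ (4 + h , g-1<len , withChordEnd-end , inj₂ (lollStep-chord h))
    ...   | yes (s≤s (s≤s z≤n)) = inj₂ (2 , ≤-trans 2<p (≤-trans (m≤m+n p 3) p+3≤len) ,
                                   withChordEnd-B 2 (between 2 ≤-refl 2<p) , inj₂ (lollStep-suc g 1))
    ...   | no i≮2 with gap-in-window 2 p 3 i (≮⇒≥ i≮2) i<len bi between after
    ...     | t , t<3 , refl = triple-dominated t t<3

  pair-and-triple-before-chord-end : DominationBound → 1 ≤ h → b 0 ≡ false → b 1 ≡ false → AllB 2 (2 + h) →
    b (2 + h) ≡ false → b (3 + h) ≡ false → b (4 + h) ≡ false → AllB (5 + h) len → ⊥
  pair-and-triple-before-chord-end bound 1≤h b₀ b₁ between b₂ b₃ b₄ after =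
    pair-and-triple bound (2 + h) (s≤s (s≤s 1≤h)) (subst (_≤ len) (+-comm 3 (2 + h)) g-1<len)
      b₀ b₁ between b₂ b₃ b₄ (subst (λ p → AllB p len) (+-comm 3 (2 + h)) after) dominated
    where
    dominated : ∀ t → t < 3 → DominatedBy withChordEnd (t + (2 + h))
    dominated 0 _ = inj₂ (1 + h , <-trans (n<1+n _) (<-trans (n<1+n _) (<-trans (n<1+n _) g-1<len)) ,
                          withChordEnd-B (1 + h) (between (1 + h) (s≤s 1≤h) ≤-refl) , inj₁ (lollStep-suc g (1 + h)))
    dominated 1 _ = inj₂ (4 + h , g-1<len , withChordEnd-end , inj₂ (lollStep-suc g (3 + h)))
    dominated 2 _ = inj₁ withChordEnd-end
    dominated (suc (suc (suc _))) (s≤s (s≤s (s≤s ())))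

  pair-and-triple-around-chord-end : DominationBound → b 0 ≡ false → b 1 ≡ false → AllB 2 (3 + h) →
    b (3 + h) ≡ false → b (4 + h) ≡ false → b (5 + h) ≡ false → 6 + h ≤ len → AllB (6 + h) len → ⊥
  pair-and-triple-around-chord-end bound b₀ b₁ between b₃ b₄ b₅ 6+h≤len after =
    pair-and-triple bound (3 + h) (s≤s (s≤s (s≤s z≤n))) (subst (_≤ len) (+-comm 3 (3 + h)) 6+h≤len)
      b₀ b₁ between b₃ b₄ b₅ (subst (λ p → AllB p len) (+-comm 3 (3 + h)) after) dominated
    where
    dominated : ∀ t → t < 3 → DominatedBy withChordEnd (t + (3 + h))
    dominated 0 _ = inj₂ (4 + h , g-1<len , withChordEnd-end , inj₂ (lollStep-suc g (3 + h)))
    dominated 1 _ = inj₁ withChordEnd-end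
    dominated 2 _ = inj₂ (4 + h , g-1<len , withChordEnd-end , inj₁ (lollStep-suc g (4 + h)))
    dominated (suc (suc (suc _))) (s≤s (s≤s (s≤s ())))

  pair-and-triple-from-chord-end : DominationBound → b 0 ≡ false → b 1 ≡ false → AllB 2 (4 + h) →
    b (4 + h) ≡ false → b (5 + h) ≡ false → b (6 + h) ≡ false → 7 + h ≤ len → AllB (7 + h) len → ⊥
  pair-and-triple-from-chord-end bound b₀ b₁ between b₄ b₅ b₆ 7+h≤len after =
    pair-and-triple bound (4 + h) (s≤s (s≤s (s≤s z≤n))) (subst (_≤ len) (+-comm 3 (4 + h)) 7+h≤len)
      b₀ b₁ between b₄ b₅ b₆ (subst (λ p → AllB p len) (+-comm 3 (4 + h)) after) dominated
    where
    7+h<len : 7 + h < len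
    7+h<len = gap<len (6 + h) 7+h≤len b₆
    dominated : ∀ t → t < 3 → DominatedBy withChordEnd (t + (4 + h))
    dominated 0 _ = inj₁ withChordEnd-end
    dominated 1 _ = inj₂ (4 + h , g-1<len , withChordEnd-end , inj₁ (lollStep-suc g (4 + h)))
    dominated 2 _ = inj₂ (7 + h , 7+h<len , withChordEnd-B (7 + h) (after (7 + h) ≤-refl 7+h<len) , inj₂ (lollStep-suc g (6 + h)))
    dominated (suc (suc (suc _))) (s≤s (s≤s (s≤s ())))

  data Pattern : Set where
    none  : AllB 0 len → Pattern
    one   : ∀ x → AllB 0 x → b x ≡ false → AllB (suc x) len → Pattern
    run   : ∀ x → x ≢ 3 + h → AllB 0 x → b x ≡ false → b (suc x) ≡ false → b (2 + x) ≡ false →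
            AllB (3 + x) len → Pattern
    wrap  : b 0 ≡ false → b 1 ≡ false → AllB 2 (4 + h) → b (4 + h) ≡ false → AllB (5 + h) len → Pattern
    cycle : h ≡ 0 → b 0 ≡ false → b 1 ≡ false → b 2 ≡ false → b 3 ≡ false → b 4 ≡ false → AllB 5 len → Pattern

  shape⇒pattern : ∀ a → AllB 0 a → NoTripleAroundChordEnd → Shape a → Pattern
  shape⇒pattern a before no-triple (no-gap after) = none (AllB-++ 0 a len before after)
  shape⇒pattern a before no-triple (gap-at x _ between bx (single after)) =
    one x (AllB-++ 0 a x before between) bx after
  shape⇒pattern a before no-triple (gap-at x _ between bx (triple bx₁ bx₂ 3+x≤len after)) =
    run x x≢3+h prefix bx bx₁ bx₂ after
    where
    prefix : AllB 0 x
    prefix = AllB-++ 0 a x before between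
    x≢3+h : x ≢ 3 + h
    x≢3+h refl = no-triple prefix bx bx₁ bx₂ 3+x≤len after

  wrapped-shape : DominationBound → b 0 ≡ false → b 1 ≡ false → b (4 + h) ≡ false → Shape 2 → Pattern
  wrapped-shape bound b₀ b₁ b₄ (no-gap after) with () ← trans (sym (after (4 + h) (s≤s (s≤s z≤n)) g-1<len)) b₄
  wrapped-shape bound b₀ b₁ b₄ (gap-at x 2≤x between bx tail) with m≤n⇒m<n∨m≡n 2≤x
  wrapped-shape bound b₀ b₁ b₄ (gap-at 2 _ _ b₂ (single after)) | inj₂ refl
    with () ← trans (sym (after (4 + h) (s≤s (s≤s (s≤s z≤n))) g-1<len)) b₄
  wrapped-shape bound b₀ b₁ b₄ (gap-at 2 _ _ b₂ (triple b₃ b₄′ _ after)) | inj₂ refl with h ≟ 0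
  ... | yes h≡0 = cycle h≡0 b₀ b₁ b₂ b₃ b₄′ after
  ... | no  h≢0 with () ← trans (sym (after (4 + h) (+-monoʳ-≤ 4 (n≢0⇒n>0 h≢0)) g-1<len)) b₄
  wrapped-shape bound b₀ b₁ b₄ (gap-at x _ between bx (single after)) | inj₁ 2<x
    with gap-in-window 2 x 1 (4 + h) (s≤s (s≤s z≤n)) g-1<len b₄ between (subst (λ p → AllB p len) (+-comm 1 x) after)
  ... | 0 , _ , refl = wrap b₀ b₁ between b₄ after
  ... | suc _ , s≤s () , _
  wrapped-shape bound b₀ b₁ b₄ (gap-at x _ between bx (triple bx₁ bx₂ 3+x≤len after)) | inj₁ 2<x
    with gap-in-window 2 x 3 (4 + h) (s≤s (s≤s z≤n)) g-1<len b₄ between (subst (λ p → AllB p len) (+-comm 3 x) after)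
  ... | 0 , _ , refl = ⊥-elim (pair-and-triple-from-chord-end bound b₀ b₁ between bx bx₁ bx₂ 3+x≤len after)
  ... | 1 , _ , refl = ⊥-elim (pair-and-triple-around-chord-end bound b₀ b₁ between bx bx₁ bx₂ 3+x≤len after)
  ... | 2 , _ , refl = ⊥-elim (pair-and-triple-before-chord-end bound (≤-pred (≤-pred 2<x)) b₀ b₁ between bx bx₁ bx₂ after)
  ... | suc (suc (suc _)) , s≤s (s≤s (s≤s ())) , _

  wrapped : DominationBound → ∀ K → 2 + K ≡ len → b 0 ≡ false → b (4 + h) ≡ false →
            excess covered 0 (2 + K) ≤ 3 + K → Pattern
  wrapped bound K eq b₀ b₄ bounded with true-or-false (b 1)
  ... | inj₂ b₁ = wrapped-shape bound b₀ b₁ b₄ (shape 2 K eq (+-cancelˡ-≤ 2 _ _ (subst (_≤ 3 + K) E bounded)))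
    where
    E : excess covered 0 (2 + K) ≡ 2 + excess chosen 2 K
    E = trans (excess-unfold covered 0 (suc K) false b₀) (cong (2 +_) (excess-unfold exposed 1 K false b₁))
  ... | inj₁ b₁ = ⊥-elim (<-irrefl refl (≤-trans (+-monoʳ-≤ 3 gap) (subst (_≤ 3 + K) E bounded)))
    where
    E : excess covered 0 (2 + K) ≡ 3 + excess chosen 2 K
    E = trans (excess-unfold covered 0 (suc K) false b₀) (cong (2 +_) (excess-unfold exposed 1 K true b₁))
    gap : suc K ≤ excess chosen 2 K
    gap = excess-≥-length-with-gap 2 K (4 + h) (s≤s (s≤s z≤n)) (subst (4 + h <_) (sym eq) g-1<len) b₄

  start-excess : DominationBound → ∀ x → b (4 + h) ≡ x → excess (chordMark x) 0 len ≤ suc len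
  start-excess bound x b₄ = subst (λ x → excess (chordMark x) 0 len ≤ suc len) b₄ (greedy-excess bound)

  classify : DominationBound → Pattern
  classify bound with true-or-false (b (4 + h))
  ... | inj₁ b₄ = shape⇒pattern 0 (λ _ _ ()) no-triple (shape 0 len refl (start-excess bound true b₄))
    where
    no-triple : NoTripleAroundChordEnd
    no-triple _ _ b₄′ _ _ _ with () ← trans (sym b₄) b₄′
  ... | inj₂ b₄ with true-or-false (b 0)
  ...   | inj₁ b₀ = shape⇒pattern 1 (λ { _ _ (s≤s z≤n) → b₀ }) (triple-around-chord-end bound) (shape 1 M refl
                      (≤-pred (subst (_≤ suc len) (excess-unfold covered 0 M true b₀) (start-excess bound false b₄))))
  ...   | inj₂ b₀ with m≤n⇒∃[o]m+o≡n (≤-trans (s≤s (s≤s z≤n)) g-1<len)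
  ...     | K , eq = wrapped bound K eq b₀ b₄ (subst (λ n → excess covered 0 n ≤ suc n) (sym eq) (start-excess bound false b₄))

  g≤len : g ≤ len
  g≤len = g-1<len

  count-nonB-B : ∀ a k → AllB a (a + k) → count nonB a k ≡ 0
  count-nonB-B a k all = count-zero-on nonB a k (λ i a≤i i< → cong not (all i a≤i i<))

  count-nonB-run : ∀ x r → AllB 0 x → b x ≡ false → b (suc x) ≡ false → b (2 + x) ≡ false →
                   AllB (3 + x) (x + 3 + r) → count nonB 0 (x + 3 + r) ≡ 3
  count-nonB-run x r before bx bx₁ bx₂ after = begin
    count nonB 0 (x + 3 + r)             ≡⟨ cong (count nonB 0) (+-assoc x 3 r) ⟩
    count nonB 0 (x + (3 + r))           ≡⟨ count-+ nonB 0 x (3 + r) ⟩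
    count nonB 0 x + count nonB x (3 + r) ≡⟨ cong₂ _+_ (count-nonB-B 0 x before) (count-+ nonB x 3 r) ⟩
    count nonB x 3 + count nonB (x + 3) r ≡⟨ cong₂ _+_ (count-three nonB x (cong not bx) (cong not bx₁) (cong not bx₂))
                                                       (count-nonB-B (x + 3) r (subst (λ a → AllB a (x + 3 + r)) (+-comm 3 x) after)) ⟩
    3 + 0                                 ∎
    where open ≡-Reasoning

  count-nonB-wrap : b 0 ≡ false → b 1 ≡ false → AllB 2 (4 + h) → b (4 + h) ≡ false → count nonB 0 g ≡ 3
  count-nonB-wrap b₀ b₁ between b₄ = begin
    count nonB 0 g                          ≡⟨ cong (λ n → count nonB 0 (4 + n)) (sym (+-comm h 1)) ⟩
    count nonB 0 (2 + (2 + h + 1))          ≡⟨ count-+ nonB 0 2 (2 + h + 1) ⟩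
    count nonB 0 2 + count nonB 2 (2 + h + 1) ≡⟨ cong₂ _+_ (count-two nonB 0 (cong not b₀) (cong not b₁))
                                                           (count-+ nonB 2 (2 + h) 1) ⟩
    2 + (count nonB 2 (2 + h) + count nonB (4 + h) 1)
                                            ≡⟨ cong (λ c → 2 + (c + count nonB (4 + h) 1)) (count-nonB-B 2 (2 + h) between) ⟩
    2 + bit (nonB (4 + h)) + 0              ≡⟨ cong (λ x → 2 + bit (not x) + 0) b₄ ⟩
    3                                       ∎
    where open ≡-Reasoning

  gaps-at-most-one : ∀ c → (∀ i → i < g → b i ≡ false → i ≡ c) → count nonB 0 g ≤ 1
  gaps-at-most-one c only-c = ≤-trans (count-mono-on nonB (_≡ᵇ c) 0 g pointwise) (count-≡ᵇ≤1 c 0 g)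
    where
    pointwise : ∀ i → 0 ≤ i → i < g → bit (nonB i) ≤ bit (i ≡ᵇ c)
    pointwise i _ i<g with true-or-false (b i)
    ... | inj₁ bi rewrite bi = z≤n
    ... | inj₂ bi rewrite bi | only-c i i<g bi = ≤-reflexive (cong bit (sym (≡ᵇ-refl c)))

  Consecutive : ℕ → ℕ → Set
  Consecutive j i = i ≡ prevOnCycle g j ⊎ i ≡ j ⊎ i ≡ suc j

  data CycleGaps : Set where
    at-most-one : count nonB 0 g ≤ 1 → CycleGaps
    three       : ∀ j → suc j < g → count nonB 0 g ≡ 3 →
                  (∀ i → i < g → b i ≡ false → Consecutive j i) → (∀ i → Consecutive j i → b i ≡ false) →
                  AllB g len → CycleGaps
    five        : h ≡ 0 → count nonB 0 g ≡ 5 → CycleGaps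

  run-gaps : ∀ x → x ≤ 2 + h → AllB 0 x → b x ≡ false → b (suc x) ≡ false → b (2 + x) ≡ false →
             AllB (3 + x) len → CycleGaps
  run-gaps x x≤2+h before bx bx₁ bx₂ after with m≤n⇒∃[o]m+o≡n x≤2+h
  ... | r , x+r≡2+h = three (suc x) 3+x≤g (subst (λ n → count nonB 0 n ≡ 3) x+3+r≡g
        (count-nonB-run x r before bx bx₁ bx₂ λ i le lt → after i le (≤-trans lt (subst (_≤ len) (sym x+3+r≡g) g≤len))))
        in-run run-is-gaps (λ i g≤i → after i (≤-trans 3+x≤g g≤i))
    where
    3+x≤g : 3 + x ≤ g
    3+x≤g = s≤s (s≤s (s≤s x≤2+h))
    x+3+r≡g : x + 3 + r ≡ g
    x+3+r≡g = trans (regroup x r) (cong (3 +_) x+r≡2+h)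
      where regroup : ∀ x r → x + 3 + r ≡ 3 + (x + r)
            regroup = solve-∀
    in-run : ∀ i → i < g → b i ≡ false → Consecutive (suc x) i
    in-run i i<g bi with gap-in-window 0 x 3 i z≤n (≤-trans i<g g≤len) bi before (subst (λ p → AllB p len) (+-comm 3 x) after)
    ... | 0 , _ , e = inj₁ e
    ... | 1 , _ , e = inj₂ (inj₁ e)
    ... | 2 , _ , e = inj₂ (inj₂ e)
    ... | suc (suc (suc _)) , s≤s (s≤s (s≤s ())) , _
    run-is-gaps : ∀ i → Consecutive (suc x) i → b i ≡ false
    run-is-gaps _ (inj₁ refl)        = bx
    run-is-gaps _ (inj₂ (inj₁ refl)) = bx₁
    run-is-gaps _ (inj₂ (inj₂ refl)) = bx₂

  cycle-gaps : Pattern → CycleGaps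
  cycle-gaps (none all) = at-most-one (gaps-at-most-one 0 λ i i<g bi →
    ⊥-elim (true≢false (trans (sym (all i z≤n (≤-trans i<g g≤len))) bi)))
  cycle-gaps (one x before bx after) = at-most-one (gaps-at-most-one x λ i i<g bi →
    gap-at-x i (gap-in-window 0 x 1 i z≤n (≤-trans i<g g≤len) bi before (subst (λ p → AllB p len) (+-comm 1 x) after)))
    where gap-at-x : ∀ i → ∃[ t ] (t < 1 × i ≡ t + x) → i ≡ x
          gap-at-x i (0 , _ , e) = e
          gap-at-x i (suc _ , s≤s () , _)
  cycle-gaps (run x x≢3+h before bx bx₁ bx₂ after) with x ≤? 2 + h
  ... | yes x≤2+h = run-gaps x x≤2+h before bx bx₁ bx₂ after
  ... | no  x≰2+h = at-most-one (gaps-at-most-one (4 + h) λ i i<g bi →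
    chord-end i i<g (gap-in-window 0 x 3 i z≤n (≤-trans i<g g≤len) bi before (subst (λ p → AllB p len) (+-comm 3 x) after)))
    where
    4+h≤x : 4 + h ≤ x
    4+h≤x with m≤n⇒m<n∨m≡n (≰⇒> x≰2+h)
    ... | inj₁ 3+h<x = 3+h<x
    ... | inj₂ 3+h≡x = ⊥-elim (x≢3+h (sym 3+h≡x))
    chord-end : ∀ i → i < g → ∃[ t ] (t < 3 × i ≡ t + x) → i ≡ 4 + h
    chord-end i i<g (t , _ , i≡t+x) = ≤-antisym (≤-pred i<g) (≤-trans 4+h≤x (subst (x ≤_) (sym i≡t+x) (m≤n+m x t)))
  cycle-gaps (wrap b₀ b₁ between b₄ after) = three 0 (s≤s (s≤s z≤n)) (count-nonB-wrap b₀ b₁ between b₄)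
    wrap-gaps (λ { _ (inj₁ refl) → b₄ ; _ (inj₂ (inj₁ refl)) → b₀ ; _ (inj₂ (inj₂ refl)) → b₁ }) after
    where
    wrap-gaps : ∀ i → i < g → b i ≡ false → Consecutive 0 i
    wrap-gaps 0 _ _ = inj₂ (inj₁ refl)
    wrap-gaps 1 _ _ = inj₂ (inj₂ refl)
    wrap-gaps (suc (suc i)) i<g bi with gap-in-window 2 (4 + h) 1 (suc (suc i)) (s≤s (s≤s z≤n)) (≤-trans i<g g≤len) bi
                                          between (subst (λ p → AllB p len) (+-comm 1 (4 + h)) after)
    ... | 0 , _ , e = inj₁ e
    ... | suc _ , s≤s () , _
  cycle-gaps (cycle h≡0 b₀ b₁ b₂ b₃ b₄ _) = five h≡0 (subst (λ h → count nonB 0 (5 + h) ≡ 5) (sym h≡0) all-five)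
    where all-five : count nonB 0 5 ≡ 5
          all-five rewrite b₀ | b₁ | b₂ | b₃ | b₄ = refl

module FGraph (h l′ m : ℕ) (host : Fin m → Fin (4 + (h + suc l′))) where

  g l : ℕ
  g = 5 + h
  l = suc l′

  -- v_{g+l} and v_{g+l−1} have indices tip and M; tip is the pendant end of the path.
  tip M : ℕ
  tip = 4 + (h + l)
  M   = 3 + (h + l)

  G : Graph (g + l + m)
  G = Fgraph g l m host

  B : ℕ → Bool
  B i = (i ≡ᵇ M) ∨ inImage host i

  Arc : ℕ → ℕ → Bool
  Arc i j = lollStep g i j ∨ lollStep g j i

  adj-lollipop : ∀ (a c : Fin (g + l)) → G (a ↑ˡ m) (c ↑ˡ m) ≡ Arc (toℕ a) (toℕ c)
  adj-lollipop a c rewrite splitAt-↑ˡ (g + l) a m | splitAt-↑ˡ (g + l) c m = refl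

  adj-attached : ∀ (a : Fin (g + l)) j → G (a ↑ˡ m) ((g + l) ↑ʳ j) ≡ (toℕ a ≡ᵇ toℕ (host j))
  adj-attached a j rewrite splitAt-↑ˡ (g + l) a m | splitAt-↑ʳ (g + l) m j = ∨-identityʳ _

  adj-attached′ : ∀ (a : Fin (g + l)) j → G ((g + l) ↑ʳ j) (a ↑ˡ m) ≡ (toℕ a ≡ᵇ toℕ (host j))
  adj-attached′ a j rewrite splitAt-↑ˡ (g + l) a m | splitAt-↑ʳ (g + l) m j = refl

  adj-attached-attached : ∀ j k → G ((g + l) ↑ʳ j) ((g + l) ↑ʳ k) ≡ false
  adj-attached-attached j k rewrite splitAt-↑ʳ (g + l) m j | splitAt-↑ʳ (g + l) m k = refl

  vertex-view : ∀ v → ∃[ a ] (a ↑ˡ m ≡ v) ⊎ ∃[ j ] ((g + l) ↑ʳ j ≡ v)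
  vertex-view v with splitAt (g + l) v in eq
  ... | inj₁ a = inj₁ (a , splitAt⁻¹-↑ˡ eq)
  ... | inj₂ j = inj₂ (j , splitAt⁻¹-↑ʳ eq)

  degree-split : ∀ u → degree G u ≡ countFin (g + l) (λ c → G u (c ↑ˡ m)) + countFin m (λ j → G u ((g + l) ↑ʳ j))
  degree-split u = trans (∣tabulate∣≡countFin (g + l + m) (G u)) (countFin-+ (g + l) m (G u))

  count-≡ᵇ≡1 : ∀ c → c < g + l → count (_≡ᵇ c) 0 (g + l) ≡ 1
  count-≡ᵇ≡1 c c<g+l = ≤-antisym (count-≡ᵇ≤1 c 0 (g + l)) (count-≥1 (_≡ᵇ c) c (g + l) (≡ᵇ-refl c) c<g+l)

  attached-pendant : ∀ j → IsPendant G ((g + l) ↑ʳ j)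
  attached-pendant j = trans (degree-split ((g + l) ↑ʳ j)) (cong₂ _+_
    (trans (countFin-cong (g + l) _ _ (λ c → adj-attached′ c j))
      (trans (countFin-toℕ (g + l) (_≡ᵇ toℕ (host j))) (count-≡ᵇ≡1 (toℕ (host j)) (<-trans (toℕ<n (host j)) (n<1+n tip)))))
    (countFin-false m (λ k → G ((g + l) ↑ʳ j) ((g + l) ↑ʳ k)) (adj-attached-attached j)))

  -- The chord test fails for tip since tip ≠ g − 1, i.e. l ≥ 1.
  tip-arc : ∀ j → j < g + l → Arc tip j ≡ (j ≡ᵇ M)
  tip-arc j j<g+l
    rewrite ≢⇒≡ᵇ≡false (suc tip) j (λ e → <-irrefl (sym e) j<g+l)
          | ≢⇒≡ᵇ≡false (h + l) h (λ e → <-irrefl (sym e) (m<m+n h (s≤s z≤n)))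
          | ∧-zeroʳ (j ≡ᵇ 0)
    = ∨-identityʳ (j ≡ᵇ M)

  Arc-sym : ∀ i j → Arc i j ≡ Arc j i
  Arc-sym i j = ∨-comm (lollStep g i j) (lollStep g j i)

  tip-vertex : Fin (g + l)
  tip-vertex = fromℕ< (n<1+n tip)

  toℕ-tip-vertex : toℕ tip-vertex ≡ tip
  toℕ-tip-vertex = toℕ-fromℕ< (n<1+n tip)

  tip-pendant : ∀ (c : Fin (g + l)) → toℕ c ≡ tip → IsPendant G (c ↑ˡ m)
  tip-pendant c c≡tip = trans (degree-split (c ↑ˡ m)) (cong₂ _+_
    (trans (countFin-cong (g + l) _ _ (λ a → trans (adj-lollipop c a)
             (trans (cong (λ i → Arc i (toℕ a)) c≡tip) (tip-arc (toℕ a) (toℕ<n a)))))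
      (trans (countFin-toℕ (g + l) (_≡ᵇ M)) (count-≡ᵇ≡1 M (<-trans (n<1+n M) (n<1+n tip)))))
    (countFin-false m (λ j → G (c ↑ˡ m) ((g + l) ↑ʳ j)) λ j → trans (adj-attached c j)
      (trans (cong (_≡ᵇ toℕ (host j)) c≡tip) (≢⇒≡ᵇ≡false tip _ (λ e → <-irrefl (sym e) (toℕ<n (host j)))))))

  two-neighbours : ∀ i → i < tip → 2 ≤ count (Arc i) 0 (g + l)
  two-neighbours zero    _ = count-≥2 (Arc 0) 1 (4 + h) (g + l)
    (cong (_∨ lollStep g 1 0) (lollStep-suc g 0)) (cong (_∨ lollStep g (4 + h) 0) (lollStep-chord h))
    (s≤s (s≤s z≤n)) (s≤s (s≤s (s≤s (s≤s (s≤s (m≤m+n h l))))))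
  two-neighbours (suc i) i<tip = count-≥2 (Arc (suc i)) i (suc (suc i)) (g + l)
    (trans (cong (lollStep g (suc i) i ∨_) (lollStep-suc g i)) (∨-zeroʳ _))
    (cong (_∨ lollStep g (suc (suc i)) (suc i)) (lollStep-suc g (suc i)))
    (<-trans (n<1+n i) (n<1+n (suc i))) (s≤s i<tip)

  inner-not-pendant : ∀ (a : Fin (g + l)) → toℕ a < tip → ¬ IsPendant G (a ↑ˡ m)
  inner-not-pendant a a<tip pendant = <-irrefl refl (begin-strict
    1                                                  <⟨ two-neighbours (toℕ a) a<tip ⟩
    count (Arc (toℕ a)) 0 (g + l)                      ≡⟨ sym (trans (countFin-cong (g + l) _ _ (adj-lollipop a))
                                                                     (countFin-toℕ (g + l) (Arc (toℕ a)))) ⟩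
    countFin (g + l) (λ c → G (a ↑ˡ m) (c ↑ˡ m))      ≤⟨ m≤m+n _ _ ⟩
    _                                                  ≡⟨ sym (degree-split (a ↑ˡ m)) ⟩
    degree G (a ↑ˡ m)                                  ≡⟨ pendant ⟩
    1                                                  ∎)
    where open ≤-Reasoning

  B⇒pdominator : ∀ (a : Fin (g + l)) → B (toℕ a) ≡ true → IsPDominator G (a ↑ˡ m)
  B⇒pdominator a Ba with true-or-false (toℕ a ≡ᵇ M)
  ... | inj₁ a≡M = tip-vertex ↑ˡ m ,
        trans (adj-lollipop a tip-vertex) (trans (Arc-sym (toℕ a) _)
          (trans (cong (λ i → Arc i (toℕ a)) toℕ-tip-vertex) (trans (tip-arc (toℕ a) (toℕ<n a)) a≡M))) ,
        tip-pendant tip-vertex toℕ-tip-vertex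
  ... | inj₂ a≢M with inImage-elim host (toℕ a) (subst (λ x → (x ∨ inImage host (toℕ a)) ≡ true) a≢M Ba)
  ...   | j , host-j≡a = (g + l) ↑ʳ j ,
          trans (adj-attached a j) (subst (λ i → (toℕ a ≡ᵇ i) ≡ true) (sym host-j≡a) (≡ᵇ-refl (toℕ a))) ,
          attached-pendant j

  pdominator⇒B : ∀ (a : Fin (g + l)) → IsPDominator G (a ↑ˡ m) → B (toℕ a) ≡ true
  pdominator⇒B a (u , a~u , u-pendant) with vertex-view u
  ... | inj₂ (j , refl) = trans (cong ((toℕ a ≡ᵇ M) ∨_)
        (subst (λ i → inImage host i ≡ true) (sym (≡ᵇ≡true⇒≡ _ _ (trans (sym (adj-attached a j)) a~u)))
               (inImage-intro host j)))
        (∨-zeroʳ _)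
  ... | inj₁ (c , refl) with toℕ c <? tip
  ...   | yes c<tip = ⊥-elim (inner-not-pendant c c<tip u-pendant)
  ...   | no  c≮tip = cong (_∨ inImage host (toℕ a)) (begin
          toℕ a ≡ᵇ M                    ≡⟨ sym (tip-arc (toℕ a) (toℕ<n a)) ⟩
          Arc tip (toℕ a)               ≡⟨ cong (λ i → Arc i (toℕ a)) (sym c≡tip) ⟩
          Arc (toℕ c) (toℕ a)           ≡⟨ Arc-sym (toℕ c) (toℕ a) ⟩
          Arc (toℕ a) (toℕ c)           ≡⟨ sym (adj-lollipop a c) ⟩
          G (a ↑ˡ m) (c ↑ˡ m)           ≡⟨ a~u ⟩
          true                          ∎)
    where
    open ≡-Reasoning
    c≡tip : toℕ c ≡ tip
    c≡tip = ≤-antisym (≤-pred (toℕ<n c)) (≮⇒≥ c≮tip)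

  B-M : B M ≡ true
  B-M = cong (_∨ inImage host M) (≡ᵇ-refl M)

  g≤M : 4 + h ≤ M
  g≤M = s≤s (s≤s (s≤s (m<m+n h (s≤s z≤n))))

  open Sweep B using (AllB)
  open Lollipop h M B B-M g≤M public hiding (g)

  lollipop-vertex : ∀ i → i < g + l → ∃[ c ] (toℕ c ≡ i)
  lollipop-vertex i i<g+l = fromℕ< i<g+l , toℕ-fromℕ< i<g+l

  lift : (ℕ → Bool) → Fin (g + l + m) → Bool
  lift d v = [ (λ a → d (toℕ a) ∧ not (toℕ a ≡ᵇ tip)) , (λ _ → false) ]′ (splitAt (g + l) v)

  lift-lollipop : ∀ d (a : Fin (g + l)) → lift d (a ↑ˡ m) ≡ (d (toℕ a) ∧ not (toℕ a ≡ᵇ tip))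
  lift-lollipop d a rewrite splitAt-↑ˡ (g + l) a m = refl

  lift-attached : ∀ d j → lift d ((g + l) ↑ʳ j) ≡ false
  lift-attached d j rewrite splitAt-↑ʳ (g + l) m j = refl

  ∈-lift : ∀ d (c : Fin (g + l)) → toℕ c < tip → d (toℕ c) ≡ true → (c ↑ˡ m) ∈ tabulate (lift d)
  ∈-lift d c c<tip dc = lookup⇒[]= (c ↑ˡ m) (tabulate (lift d)) (trans (lookup∘tabulate (lift d) (c ↑ˡ m))
    (trans (lift-lollipop d c) (cong₂ (λ x y → x ∧ not y) dc (≢⇒≡ᵇ≡false (toℕ c) tip (λ e → <-irrefl e c<tip)))))

  neighbour-in-lift : ∀ d i v → i < tip → d i ≡ true → (∀ c → toℕ c ≡ i → G (c ↑ˡ m) v ≡ true) →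
                      ∃[ u ] (u ∈ tabulate (lift d) × G u v ≡ true)
  neighbour-in-lift d i v i<tip di adj with lollipop-vertex i (<-trans i<tip (n<1+n tip))
  ... | c , refl = c ↑ˡ m , ∈-lift d c i<tip di , adj c refl

  Adjacent⇒Arc : ∀ i j → Adjacent i j → Arc i j ≡ true
  Adjacent⇒Arc i j (inj₁ i→j) = cong (_∨ lollStep g j i) i→j
  Adjacent⇒Arc i j (inj₂ j→i) = trans (cong (lollStep g i j ∨_) j→i) (∨-zeroʳ _)

  B-host : ∀ j → B (toℕ (host j)) ≡ true
  B-host j = trans (cong ((toℕ (host j) ≡ᵇ M) ∨_) (inImage-intro host j)) (∨-zeroʳ _)

  lift-dominating : ∀ d → Contains-B d → Dominates d → IsDominating G (tabulate (lift d))
  lift-dominating d d⊇B d-dom v with vertex-view v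
  ... | inj₂ (j , refl) = inj₂ (neighbour-in-lift d (toℕ (host j)) ((g + l) ↑ʳ j) (toℕ<n (host j))
        (d⊇B _ (toℕ<n (host j)) (B-host j))
        λ c c≡host → trans (adj-attached c j)
          (subst (λ i → (i ≡ᵇ toℕ (host j)) ≡ true) (sym c≡host) (≡ᵇ-refl (toℕ (host j)))))
  ... | inj₁ (a , refl) with toℕ a <? tip
  ...   | no a≮tip = inj₂ (neighbour-in-lift d M (a ↑ˡ m) (n<1+n M) (d⊇B M (n<1+n M) B-M) λ c c≡M → begin
          G (c ↑ˡ m) (a ↑ˡ m)   ≡⟨ adj-lollipop c a ⟩
          Arc (toℕ c) (toℕ a)   ≡⟨ cong₂ Arc c≡M (≤-antisym (≤-pred (toℕ<n a)) (≮⇒≥ a≮tip)) ⟩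
          Arc M tip             ≡⟨ Arc-sym M tip ⟩
          Arc tip M             ≡⟨ tip-arc M (<-trans (n<1+n M) (n<1+n tip)) ⟩
          M ≡ᵇ M                ≡⟨ ≡ᵇ-refl M ⟩
          true                  ∎)
    where open ≡-Reasoning
  ...   | yes a<tip with d-dom (toℕ a) a<tip
  ...     | inj₁ da = inj₁ (∈-lift d a a<tip da)
  ...     | inj₂ (j , j<tip , dj , j~a) = inj₂ (neighbour-in-lift d j (a ↑ˡ m) j<tip dj λ c c≡j →
            trans (adj-lollipop c a) (trans (cong (λ i → Arc i (toℕ a)) c≡j) (Adjacent⇒Arc j (toℕ a) j~a)))

  lift-size : ∀ d → ∣ tabulate (lift d) ∣ ≤ count d 0 tip
  lift-size d = begin
    ∣ tabulate (lift d) ∣                       ≡⟨ trans (∣tabulate∣≡countFin (g + l + m) (lift d))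
                                                         (countFin-+ (g + l) m (lift d)) ⟩
    countFin (g + l) (λ a → lift d (a ↑ˡ m)) + countFin m (λ j → lift d ((g + l) ↑ʳ j))
                                                ≡⟨ cong₂ _+_ (trans (countFin-cong (g + l) _ _ (lift-lollipop d)) (countFin-toℕ (g + l) q))
                                                             (countFin-false m _ (lift-attached d)) ⟩
    count q 0 (suc tip) + 0                     ≡⟨ trans (+-identityʳ _) (cong (count q 0) (+-comm 1 tip)) ⟩
    count q 0 (tip + 1)                         ≡⟨ count-+ q 0 tip 1 ⟩
    count q 0 tip + (bit (d tip ∧ not (tip ≡ᵇ tip)) + 0)
                                                ≡⟨ cong (λ x → count q 0 tip + (bit (d tip ∧ not x) + 0)) (≡ᵇ-refl tip) ⟩
    count q 0 tip + (bit (d tip ∧ false) + 0)   ≡⟨ cong (λ x → count q 0 tip + (bit x + 0)) (∧-zeroʳ (d tip)) ⟩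
    count q 0 tip + 0                           ≡⟨ +-identityʳ _ ⟩
    count q 0 tip                               ≤⟨ count-mono q d 0 tip q≤d ⟩
    count d 0 tip                               ∎
    where
    open ≤-Reasoning
    q : ℕ → Bool
    q i = d i ∧ not (i ≡ᵇ tip)
    q≤d : ∀ i → bit (q i) ≤ bit (d i)
    q≤d i with d i
    ... | true  = bit-≤1 (not (i ≡ᵇ tip))
      where bit-≤1 : ∀ x → bit x ≤ 1
            bit-≤1 true  = ≤-refl
            bit-≤1 false = z≤n
    ... | false = z≤n

  count-B≤ : count B 0 tip ≤ 1 + m
  count-B≤ = ≤-trans (count-∨ (_≡ᵇ M) (inImage host) 0 tip) (+-mono-≤ (count-≡ᵇ≤1 M 0 tip) (count-inImage≤ host 0 tip))

  domination-bound : ∀ γ → (∀ D → IsDominating G D → γ ≤ ∣ D ∣) → 2 * γ + 1 ≡ g + l + m → DominationBound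
  domination-bound γ minimal n≡2γ+1 d d⊇B d-dom = begin
    tip + count B 0 tip      ≤⟨ +-monoʳ-≤ tip count-B≤ ⟩
    tip + suc m              ≡⟨ trans (+-suc tip m) (sym n≡2γ+1) ⟩
    2 * γ + 1                ≤⟨ +-monoˡ-≤ 1 (*-monoʳ-≤ 2 γ≤d) ⟩
    2 * count d 0 tip + 1    ∎
    where
    open ≤-Reasoning
    γ≤d : γ ≤ count d 0 tip
    γ≤d = ≤-trans (minimal _ (lift-dominating d d⊇B d-dom)) (lift-size d)

  toℕ-cyc : ∀ (i : Fin g) → toℕ (i ↑ˡ l) ≡ toℕ i
  toℕ-cyc i = toℕ-↑ˡ i l

  cyc-pdominator⇒B : ∀ (i : Fin g) → IsPDominator G (cyc g l m i) → B (toℕ i) ≡ true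
  cyc-pdominator⇒B i pd = subst (λ n → B n ≡ true) (toℕ-cyc i) (pdominator⇒B (i ↑ˡ l) pd)

  B⇒cyc-pdominator : ∀ (i : Fin g) → B (toℕ i) ≡ true → IsPDominator G (cyc g l m i)
  B⇒cyc-pdominator i Bi = B⇒pdominator (i ↑ˡ l) (subst (λ n → B n ≡ true) (sym (toℕ-cyc i)) Bi)

  B⇒pdominator′ : ∀ (v : Fin (g + l + m)) → toℕ v < tip → B (toℕ v) ≡ true → IsPDominator G v
  B⇒pdominator′ v v<tip Bv with lollipop-vertex (toℕ v) (<-trans v<tip (n<1+n tip))
  ... | c , c≡v = subst (IsPDominator G) (toℕ-injective (trans (toℕ-↑ˡ c m) c≡v))
                    (B⇒pdominator c (subst (λ n → B n ≡ true) (sym c≡v) Bv))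

  module _ (S : Subset g) (S-spec : ∀ i → i ∈ S ⇔ (¬ IsPDominator G (cyc g l m i))) where

    ∈S⇒gap : ∀ i → i ∈ S → B (toℕ i) ≡ false
    ∈S⇒gap i i∈S with true-or-false (B (toℕ i))
    ... | inj₁ Bi = ⊥-elim (Equivalence.to (S-spec i) i∈S (B⇒cyc-pdominator i Bi))
    ... | inj₂ Bi = Bi

    gap⇒∈S : ∀ i → B (toℕ i) ≡ false → i ∈ S
    gap⇒∈S i Bi = Equivalence.from (S-spec i) λ pd → true≢false (trans (sym (cyc-pdominator⇒B i pd)) Bi)

    lookup-S : ∀ i → lookup S i ≡ nonB (toℕ i)
    lookup-S i with true-or-false (lookup S i)
    ... | inj₁ Si = trans Si (cong not (sym (∈S⇒gap i (lookup⇒[]= i S Si))))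
    ... | inj₂ Si with true-or-false (B (toℕ i))
    ...   | inj₁ Bi = trans Si (cong not (sym Bi))
    ...   | inj₂ Bi with () ← trans (sym Si) ([]=⇒lookup (gap⇒∈S i Bi))

    ∣S∣≡gaps : ∣ S ∣ ≡ count nonB 0 g
    ∣S∣≡gaps = trans (cong ∣_∣ (trans (sym (tabulate∘lookup S)) (tabulate-cong lookup-S)))
                     (trans (∣tabulate∣≡countFin g (λ i → nonB (toℕ i))) (countFin-toℕ g nonB))

    consecutive-gaps : ∀ {f} → CycleGaps → f ≡ count nonB 0 g → f ≡ 3 →
      Σ ℕ λ j → suc j < g ×
        (∀ (i : Fin g) → (i ∈ S ⇔ (toℕ i ≡ prevOnCycle g j ⊎ toℕ i ≡ j ⊎ toℕ i ≡ suc j))) ×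
        (∀ (i : Fin g) → toℕ i ≢ prevOnCycle g j → toℕ i ≢ j → toℕ i ≢ suc j → IsPDominator G (cyc g l m i)) ×
        (∀ (v : Fin (g + l + m)) → g ≤ toℕ v → toℕ v < g + l ∸ 1 → IsPDominator G v)
    consecutive-gaps (at-most-one ≤1) refl f≡3 with s≤s () ← ≤-trans (≤-reflexive (sym f≡3)) ≤1
    consecutive-gaps (five _ ≡5) refl f≡3 with () ← trans (sym ≡5) f≡3
    consecutive-gaps (three j j+1<g _ only-run run-gaps after) _ _ =
      j , j+1<g ,
      (λ i → mk⇔ (λ i∈S → only-run (toℕ i) (toℕ<n i) (∈S⇒gap i i∈S)) (gap⇒∈S i ∘ run-gaps (toℕ i))) ,
      outside , (λ v g≤v v<tip → B⇒pdominator′ v v<tip (after (toℕ v) g≤v v<tip))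
      where
      outside : ∀ (i : Fin g) → toℕ i ≢ prevOnCycle g j → toℕ i ≢ j → toℕ i ≢ suc j → IsPDominator G (cyc g l m i)
      outside i ≢prev ≢j ≢suc-j with true-or-false (B (toℕ i))
      ... | inj₁ Bi = B⇒cyc-pdominator i Bi
      ... | inj₂ Bi with only-run (toℕ i) (toℕ<n i) Bi
      ...   | inj₁ e        = ⊥-elim (≢prev e)
      ...   | inj₂ (inj₁ e) = ⊥-elim (≢j e)
      ...   | inj₂ (inj₂ e) = ⊥-elim (≢suc-j e)

  all-gaps : ∀ {f} → CycleGaps → f ≡ count nonB 0 g → f ≡ g → g ≡ 5
  all-gaps (at-most-one ≤1) refl f≡g with s≤s () ← ≤-trans (≤-reflexive (sym f≡g)) ≤1
  all-gaps (three _ _ ≡3 _ _ _) refl f≡g with () ← trans (sym f≡g) ≡3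
  all-gaps (five h≡0 _) _ _ = cong (5 +_) h≡0

  few-gaps : ∀ {f} → CycleGaps → f ≡ count nonB 0 g → f ≢ g → f ≤ 3 × f ≢ 2
  few-gaps (at-most-one ≤1) refl _ = ≤-trans ≤1 (s≤s z≤n) , λ f≡2 → 2≰1 (subst (_≤ 1) f≡2 ≤1)
    where 2≰1 : ¬ 2 ≤ 1
          2≰1 (s≤s ())
  few-gaps (three _ _ ≡3 _ _ _) refl _ = ≤-reflexive ≡3 , λ f≡2 → 3≢2 (trans (sym ≡3) f≡2)
    where 3≢2 : 3 ≢ 2
          3≢2 ()
  few-gaps (five h≡0 ≡5) refl f≢g = ⊥-elim (f≢g (trans ≡5 (cong (5 +_) (sym h≡0))))

theorem3p2 : (g l m : ℕ) → (host : Fin m → Fin (g + l ∸ 1)) →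
    5 ≤ g → 1 ≤ l → g + 1 ≤ g + l + m →
    (∀ (v : Fin (g + l + m)) → toℕ v ≢ g + l ∸ 2 →
       IsPDominator (Fgraph g l m host) v →
       AdjToExactlyOnePendant (Fgraph g l m host) v) →
    ¬ IsBipartite (Fgraph g l m host) →
    (γ : ℕ) → IsDominationNumber (Fgraph g l m host) γ → 2 * γ + 1 ≡ g + l + m →
    (S : Subset g) →
    (∀ (i : Fin g) → (i ∈ S ⇔ (¬ IsPDominator (Fgraph g l m host) (cyc g l m i)))) →
    (f : ℕ) → ∣ S ∣ ≡ f →
    (f ≡ g → g ≡ 5) ×
    (f ≢ g → f ≤ 3 × f ≢ 2) ×
    (f ≡ 3 →
      Σ ℕ λ j → suc j < g ×
        (∀ (i : Fin g) →
          (i ∈ S ⇔ (toℕ i ≡ prevOnCycle g j ⊎ toℕ i ≡ j ⊎ toℕ i ≡ suc j))) ×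
        (∀ (i : Fin g) → toℕ i ≢ prevOnCycle g j → toℕ i ≢ j → toℕ i ≢ suc j →
          IsPDominator (Fgraph g l m host) (cyc g l m i)) ×
        (∀ (v : Fin (g + l + m)) → g ≤ toℕ v → toℕ v < g + l ∸ 1 →
          IsPDominator (Fgraph g l m host) v))
theorem3p2 _ _ m host (s≤s (s≤s (s≤s (s≤s (s≤s (z≤n {h})))))) (s≤s (z≤n {l′})) _ _ _
           γ (_ , minimal) n≡2γ+1 S S-spec f ∣S∣≡f =
  all-gaps gaps f≡gaps , few-gaps gaps f≡gaps , consecutive-gaps S S-spec gaps f≡gaps
  where
  open FGraph h l′ m host
  gaps : CycleGaps
  gaps = cycle-gaps (classify (domination-bound γ minimal n≡2γ+1))
  f≡gaps : f ≡ count nonB 0 g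
  f≡gaps = trans (sym ∣S∣≡f) (∣S∣≡gaps S S-spec)
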